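{- Let $0\le r<n$ and let $e_I$ be an admissible product of exactly $s$ Taylor generators whose least common multiple is $m_I=x_0x_1\cdots x_{2^n-1}$. Then $e_I=e_J\Theta_n$, where $e_J$ is an admissible product of exactly $s-2^{n-1}$ Taylor generators.
   Context: Identify $Q_n=\{0,1\}^n$ with $\{0,\ldots,2^n-1\}$ via binary expansion, with Hamming distance $d_H$; $\overline{a}$ denotes the bitwise complement of $a$ (so $d_H(a,\overline a)=n$). The Stanley--Reisner ideal of $VR(Q_n;r)$ (the complex on $Q_n$ whose simplices are subsets of $d_H$-diameter $\le r$) is generated by $x_ax_b$, $a<b$, $d_H(a,b)>r$; to each associate an exterior symbol $e_{(a,b)}$ (Taylor generator). Generators are totally ordered by: $x_ax_b<x_cx_d$ if $d_H(a,b)<d_H(c,d)$, and lexicographically in the pairs when distances are equal. With $m_i$ the monomial of the $i$-th generator, a product $e_I=e_{i_1}\cdots e_{i_t}$ ($i_1<\cdots<i_t$) has $m_I=\operatorname{lcm}(m_{i_1},\ldots,m_{i_t})$ and is admissible if for every $h$ and every generator index $q>i_h$, $m_q\nmid \operatorname{lcm}(m_{i_1},\ldots,m_{i_h})$. $\Theta_n=\prod_{i=0}^{2^{n-1}-1}e_{(i,\overline i)}$ (factors in increasing order); products are in the exterior algebra on the $e$'s. -}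

module Defs where

open import Data.Nat using (ℕ; zero; suc; _+_; _*_; _∸_; _^_; _≤_; _<_; _⊔_; _/_; _%_; _≡ᵇ_; _<ᵇ_)
open import Data.Bool using (Bool; true; false; if_then_else_; _∧_; _∨_; not; T)
open import Data.Product using (_×_; _,_; proj₁; proj₂)
open import Data.Maybe using (Maybe; just; nothing)
open import Data.Sign using (Sign) renaming (_*_ to _*ˢ_)
open import Data.List using (List; []; _∷_; _++_; map; upTo; length; take; lookup; foldr)
open import Data.List.Relation.Unary.All using (All)
open import Data.List.Relation.Unary.Linked using (Linked)
open import Data.Fin using (fromℕ<)
open import Relation.Nullary using (¬_)
open import Relation.Binary.PropositionalEquality using (_≡_)

-- Vertices of Q_n are naturals a < 2^n (binary expansion).

bit : ℕ → ℕ → ℕ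
bit a zero    = a % 2
bit a (suc i) = bit (a / 2) i

dH : ℕ → ℕ → ℕ → ℕ
dH zero    a b = 0
dH (suc k) a b = (if bit a k ≡ᵇ bit b k then 0 else 1) + dH k a b

-- bitwise complement in Q_n
comp : ℕ → ℕ → ℕ
comp n a = (2 ^ n ∸ 1) ∸ a

-- Taylor generators e_(a,b) are represented by the pair (a , b).

Pair : Set
Pair = ℕ × ℕ

-- (a,b) is a generator of the Stanley–Reisner ideal of VR(Q_n; r):
-- a < b < 2^n and d_H(a,b) > r
IsGen : ℕ → ℕ → Pair → Set
IsGen n r (a , b) = (a < b) × (b < 2 ^ n) × (r < dH n a b)

ltᵇ : ℕ → Pair → Pair → Bool
ltᵇ n (a , b) (c , d) =
  (dH n a b <ᵇ dH n c d) ∨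
  ((dH n a b ≡ᵇ dH n c d) ∧ ((a <ᵇ c) ∨ ((a ≡ᵇ c) ∧ (b <ᵇ d))))

_≺[_]_ : Pair → ℕ → Pair → Set
p ≺[ n ] q = T (ltᵇ n p q)

eqᵇ : Pair → Pair → Bool
eqᵇ (a , b) (c , d) = (a ≡ᵇ c) ∧ (b ≡ᵇ d)

-- Monomials in the variables x_v (v : ℕ), as exponent vectors.

Monomial : Set
Monomial = ℕ → ℕ

mon : Pair → Monomial
mon (a , b) v = (if v ≡ᵇ a then 1 else 0) + (if v ≡ᵇ b then 1 else 0)

one : Monomial
one v = 0

lcmₘ : Monomial → Monomial → Monomial
lcmₘ m m' v = m v ⊔ m' v

lcmList : List Pair → Monomial
lcmList = foldr (λ g m → lcmₘ (mon g) m) one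

_∣ₘ_ : Monomial → Monomial → Set
m ∣ₘ m' = ∀ v → m v ≤ m' v

_≈ₘ_ : Monomial → Monomial → Set
m ≈ₘ m' = ∀ v → m v ≡ m' v

fullMon : ℕ → Monomial
fullMon n v = if v <ᵇ 2 ^ n then 1 else 0

-- Products e_I, with I a strictly increasing list of generators.

Admissible : ℕ → ℕ → List Pair → Set
Admissible n r I =
  ∀ h (lt : h < length I) (q : Pair) → IsGen n r q →
    lookup I (fromℕ< lt) ≺[ n ] q → ¬ (mon q ∣ₘ lcmList (take (suc h) I))

AdmissibleProduct : ℕ → ℕ → List Pair → Set
AdmissibleProduct n r I =
  All (IsGen n r) I × Linked (_≺[ n ]_) I × Admissible n r I

-- Exterior algebra on the e's: a word (product of generators, in the
-- given order) is either 0 (nothing) or ± a standard monomial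
-- (strictly increasing list of generators).

ExtMonomial : Set
ExtMonomial = Maybe (Sign × List Pair)

-- multiply e_g on the left of a standard monomial e_l
insertE : ℕ → Pair → List Pair → Maybe (Sign × List Pair)
insertE n g [] = just (Sign.+ , g ∷ [])
insertE n g (h ∷ t) with eqᵇ g h | ltᵇ n g h
... | true  | _     = nothing
... | false | true  = just (Sign.+ , g ∷ h ∷ t)
... | false | false with insertE n g t
...   | nothing       = nothing
...   | just (σ , t') = just (σ *ˢ Sign.- , h ∷ t')

extProd : ℕ → List Pair → ExtMonomial
extProd n [] = just (Sign.+ , [])
extProd n (g ∷ w) with extProd n w
... | nothing      = nothing
... | just (σ , l) with insertE n g l
...   | nothing        = nothing
...   | just (τ , l')  = just (τ *ˢ σ , l')

-- the factors of Θ_n = ∏_{i=0}^{2^{n-1}-1} e_(i, ī), in increasing order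
thetaList : ℕ → List Pair
thetaList n = map (λ i → (i , comp n i)) (upTo (2 ^ (n ∸ 1)))

-- Write N = 2^(n-1) and θ_i = (i, ī). We peel Θ_n off the end of I one factor at a time, from
-- θ_{N-1} down to θ_0. Suppose I = J θ_{i+1} ⋯ θ_{N-1}. Since x_i x_ī divides m_I and the later
-- factors involve neither x_i nor x_ī, m_{θ_i} divides lcm(J); in particular J has a last factor g.
-- Admissibility at g forbids g ≺ θ_i, so d_H(g) = n, i.e. g = θ_a for some a < N with i ≤ a; and
-- a > i is impossible because g ≺ θ_{i+1} forces a ≤ i. Hence g = θ_i.
-- Distance n means a + b + 1 = 2^n, which is proved one binary digit at a time.
module Submission where

open import Defs
open import Data.Bool using (true; false; if_then_else_; T; _∧_; _∨_)
open import Data.Bool.Properties using (T-≡; T-∨; T-∧)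
open import Data.Fin using (fromℕ<)
open import Data.List using (List; []; _∷_; _++_; _∷ʳ_; map; upTo; applyUpTo; length; take; lookup; initLast; _∷ʳ′_)
open import Data.List.Properties using (++-assoc; ++-identityʳ; length-++; length-++-≤ˡ; length-++-sucʳ; length-map; length-upTo)
open import Data.List.Relation.Unary.All as All using (All; []; _∷_)
import Data.List.Relation.Unary.All.Properties as AllP
open import Data.List.Relation.Unary.Linked as Linked using (Linked; []; [-]; _∷_)
open import Data.Nat
open import Data.Nat.DivMod using (m≡m%n+[m/n]*n; m%n<n; m<n*o⇒m/o<n)
open import Data.Nat.Properties
open import Algebra.Properties.CommutativeSemigroup +-commutativeSemigroup using (x∙yz≈y∙xz)
open import Data.Nat.Tactic.RingSolver using (solve-∀)
open import Data.Product as Product using (Σ; ∃-syntax; _×_; _,_; proj₁; proj₂)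
open import Data.Product.Function.NonDependent.Propositional using (_×-⇔_)
open import Data.Sum as Sum using (_⊎_; inj₁; inj₂)
open import Function using (_∘_; const; id)
open import Function.Bundles using (_⇔_; mk⇔; Equivalence)
import Function.Properties.Equivalence as ⇔
open import Function.Construct.Identity using (⇔-id)
open import Relation.Binary using (tri<; tri≈; tri>)
open import Relation.Binary.PropositionalEquality
open import Relation.Nullary using (¬_; yes; no; contradiction)

-- Binary digits and the Hamming distance

≡ᵇ-refl : ∀ x → (x ≡ᵇ x) ≡ true
≡ᵇ-refl x = Equivalence.to T-≡ (≡⇒≡ᵇ x x refl)

≡ᵇ-≢ : ∀ {x y} → x ≢ y → (x ≡ᵇ y) ≡ false
≡ᵇ-≢ {x} {y} x≢y with x ≡ᵇ y in eq
... | true  = contradiction (≡ᵇ⇒≡ x y (Equivalence.from T-≡ eq)) x≢y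
... | false = refl

bitDist : ℕ → ℕ → ℕ
bitDist x y = if x ≡ᵇ y then 0 else 1

bitDist≤1 : ∀ x y → bitDist x y ≤ 1
bitDist≤1 x y with x ≡ᵇ y
... | true  = z≤n
... | false = ≤-refl

bitDist≡1⇔≢ : ∀ x y → bitDist x y ≡ 1 ⇔ x ≢ y
bitDist≡1⇔≢ x y with x ≟ y
... | yes refl rewrite ≡ᵇ-refl x = mk⇔ (λ ()) (λ x≢x → contradiction refl x≢x)
... | no x≢y   rewrite ≡ᵇ-≢ x≢y  = mk⇔ (const x≢y) (const refl)

dH≤ : ∀ k a b → dH k a b ≤ k
dH≤ zero    a b = z≤n
dH≤ (suc k) a b = +-mono-≤ (bitDist≤1 (bit a k) (bit b k)) (dH≤ k a b)

dH-unfoldLowest : ∀ k a b → dH (suc k) a b ≡ bitDist (a % 2) (b % 2) + dH k (a / 2) (b / 2)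
dH-unfoldLowest zero    a b = refl
dH-unfoldLowest (suc k) a b = begin
  top + dH (suc k) a b                ≡⟨ cong (top +_) (dH-unfoldLowest k a b) ⟩
  top + (low + dH k (a / 2) (b / 2))  ≡⟨ x∙yz≈y∙xz top low (dH k (a / 2) (b / 2)) ⟩
  low + (top + dH k (a / 2) (b / 2))  ∎
  where
  open ≡-Reasoning
  top = bitDist (bit (a / 2) k) (bit (b / 2) k)
  low = bitDist (a % 2) (b % 2)

m+n≡o+p⇔m≡o×n≡p : ∀ {m n o p} → m ≤ o → n ≤ p → m + n ≡ o + p ⇔ (m ≡ o × n ≡ p)
m+n≡o+p⇔m≡o×n≡p {m} {n} {o} {p} m≤o n≤p = mk⇔ split (λ (m≡o , n≡p) → cong₂ _+_ m≡o n≡p)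
  where
  split : m + n ≡ o + p → m ≡ o × n ≡ p
  split e = m≡o , +-cancelˡ-≡ o n p (trans (cong (_+ n) (sym m≡o)) e)
    where
    m≡o : m ≡ o
    m≡o = ≤-antisym m≤o (≮⇒≥ (λ m<o → <-irrefl e (+-mono-<-≤ m<o n≤p)))

dH≡suc⇔ : ∀ k a b → dH (suc k) a b ≡ suc k ⇔ (a % 2 ≢ b % 2 × dH k (a / 2) (b / 2) ≡ k)
dH≡suc⇔ k a b rewrite dH-unfoldLowest k a b =
  ⇔.trans (m+n≡o+p⇔m≡o×n≡p (bitDist≤1 (a % 2) (b % 2)) (dH≤ k (a / 2) (b / 2)))
    (bitDist≡1⇔≢ (a % 2) (b % 2) ×-⇔ ⇔-id _)

digits≢⇒sum≡1 : ∀ {x y} → x < 2 → y < 2 → x ≢ y → x + y ≡ 1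
digits≢⇒sum≡1 {0}     {0}     _ _ 0≢0 = contradiction refl 0≢0
digits≢⇒sum≡1 {0}     {1}     _ _ _   = refl
digits≢⇒sum≡1 {1}     {0}     _ _ _   = refl
digits≢⇒sum≡1 {1}     {1}     _ _ 1≢1 = contradiction refl 1≢1
digits≢⇒sum≡1 {suc (suc _)} (s≤s (s≤s ())) _ _
digits≢⇒sum≡1 {_} {suc (suc _)} _ (s≤s (s≤s ())) _

suc-+-digits : ∀ a b → suc (a + b) ≡ suc ((a % 2 + a / 2 * 2) + (b % 2 + b / 2 * 2))
suc-+-digits a b = cong₂ (λ x y → suc (x + y)) (m≡m%n+[m/n]*n a 2) (m≡m%n+[m/n]*n b 2)

suc-+≡2*⇔ : ∀ a b M → suc (a + b) ≡ 2 * M ⇔ (a % 2 ≢ b % 2 × suc (a / 2 + b / 2) ≡ M)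
suc-+≡2*⇔ a b M with a % 2 ≟ b % 2
... | yes same = mk⇔ (λ e → contradiction (trans (sym odd) e) (even≢odd M (a % 2 + (a / 2 + b / 2)) ∘ sym))
                     (λ (differ , _) → contradiction same differ)
  where
  odd : suc (a + b) ≡ suc (2 * (a % 2 + (a / 2 + b / 2)))
  odd = begin
    suc (a + b)                                             ≡⟨ suc-+-digits a b ⟩
    suc ((a % 2 + a / 2 * 2) + (b % 2 + b / 2 * 2))
      ≡⟨ cong (λ d → suc ((a % 2 + a / 2 * 2) + (d + b / 2 * 2))) (sym same) ⟩
    suc ((a % 2 + a / 2 * 2) + (a % 2 + b / 2 * 2))         ≡⟨ regroup (a % 2) (a / 2) (b / 2) ⟩
    suc (2 * (a % 2 + (a / 2 + b / 2)))                     ∎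
    where
    open ≡-Reasoning
    regroup : ∀ d x y → suc ((d + x * 2) + (d + y * 2)) ≡ suc (2 * (d + (x + y)))
    regroup = solve-∀
... | no differ = mk⇔ (λ e → differ , *-cancelˡ-≡ _ M 2 (trans (sym even) e))
                      (λ (_ , e) → trans even (cong (2 *_) e))
  where
  even : suc (a + b) ≡ 2 * suc (a / 2 + b / 2)
  even = begin
    suc (a + b)                                             ≡⟨ suc-+-digits a b ⟩
    suc ((a % 2 + a / 2 * 2) + (b % 2 + b / 2 * 2))         ≡⟨ regroup (a % 2) (b % 2) (a / 2) (b / 2) ⟩
    suc (a % 2 + b % 2) + 2 * (a / 2 + b / 2)
      ≡⟨ cong (λ s → suc s + 2 * (a / 2 + b / 2)) (digits≢⇒sum≡1 (m%n<n a 2) (m%n<n b 2) differ) ⟩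
    2 + 2 * (a / 2 + b / 2)                                 ≡⟨ sym (*-distribˡ-+ 2 1 (a / 2 + b / 2)) ⟩
    2 * suc (a / 2 + b / 2)                                 ∎
    where
    open ≡-Reasoning
    regroup : ∀ d e x y → suc ((d + x * 2) + (e + y * 2)) ≡ suc (d + e) + 2 * (x + y)
    regroup = solve-∀

/2-< : ∀ {a k} → a < 2 ^ suc k → a / 2 < 2 ^ k
/2-< {a} {k} a< = m<n*o⇒m/o<n (subst (a <_) (*-comm 2 (2 ^ k)) a<)

dH≡k⇔antipodal : ∀ k {a b} → a < 2 ^ k → b < 2 ^ k → dH k a b ≡ k ⇔ suc (a + b) ≡ 2 ^ k
dH≡k⇔antipodal zero    {zero}  {zero}  _ _ = mk⇔ (const refl) (const refl)
dH≡k⇔antipodal zero    {suc _} (s≤s ()) _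
dH≡k⇔antipodal zero    {zero}  {suc _} _ (s≤s ())
dH≡k⇔antipodal (suc k) {a} {b} a< b< =
  ⇔.trans (dH≡suc⇔ k a b)
    (⇔.trans (⇔-id _ ×-⇔ dH≡k⇔antipodal k (/2-< {k = k} a<) (/2-< {k = k} b<))
             (⇔.sym (suc-+≡2*⇔ a b (2 ^ k))))

-- Antipodal vertices

antipodal-< : ∀ {a b M} → suc (a + b) ≡ M → b < M
antipodal-< {a} {b} e = subst (b <_) e (s≤s (m≤n+m b a))

comp-antipodal : ∀ n {a} → a < 2 ^ n → suc (a + comp n a) ≡ 2 ^ n
comp-antipodal n {a} a< = begin
  suc (a + (pred (2 ^ n) ∸ a))  ≡⟨ cong suc (m+[n∸m]≡n (suc[m]≤n⇒m≤pred[n] a<)) ⟩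
  suc (pred (2 ^ n))            ≡⟨ suc-pred (2 ^ n) {{m^n≢0 2 n}} ⟩
  2 ^ n                         ∎
  where open ≡-Reasoning

antipodal⇒≡comp : ∀ n {a b} → suc (a + b) ≡ 2 ^ n → b ≡ comp n a
antipodal⇒≡comp n {a} {b} e = sym (trans (cong (λ x → pred x ∸ a) (sym e)) (m+n∸m≡n a b))

comp-injective : ∀ n {a c} → a < 2 ^ n → c < 2 ^ n → comp n a ≡ comp n c → a ≡ c
comp-injective n {a} {c} a< c< e = +-cancelʳ-≡ (comp n a) a c (suc-injective (begin
  suc (a + comp n a)  ≡⟨ comp-antipodal n a< ⟩
  2 ^ n               ≡⟨ comp-antipodal n c< ⟨
  suc (c + comp n c)  ≡⟨ cong (λ x → suc (c + x)) e ⟨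
  suc (c + comp n a)  ∎))
  where open ≡-Reasoning

dH-comp : ∀ n {a} → a < 2 ^ n → dH n a (comp n a) ≡ n
dH-comp n a< = Equivalence.from (dH≡k⇔antipodal n a< (antipodal-< (comp-antipodal n a<))) (comp-antipodal n a<)

dH≡n⇒≡comp : ∀ n {a b} → a < 2 ^ n → b < 2 ^ n → dH n a b ≡ n → b ≡ comp n a
dH≡n⇒≡comp n a< b< = antipodal⇒≡comp n ∘ Equivalence.to (dH≡k⇔antipodal n a< b<)

antipodal-lower : ∀ {a b N} → suc (a + b) ≡ 2 * N → a < b → a < N
antipodal-lower {a} {b} {N} e a<b with a <? N
... | yes a<N = a<N
... | no a≮N  = contradiction e (≢-sym (<⇒≢ 2N<))
  where
  open ≤-Reasoning
  N≤a = ≮⇒≥ a≮N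
  2N< : 2 * N < suc (a + b)
  2N< = begin-strict
    2 * N        ≡⟨ cong (N +_) (+-identityʳ N) ⟩
    N + N        ≤⟨ +-mono-≤ N≤a (≤-trans N≤a (<⇒≤ a<b)) ⟩
    a + b        <⟨ n<1+n (a + b) ⟩
    suc (a + b)  ∎

antipodal-upper : ∀ {a b N} → suc (a + b) ≡ 2 * N → a < N → N ≤ b
antipodal-upper {a} {b} {N} e a<N with N ≤? b
... | yes N≤b = N≤b
... | no N≰b  = contradiction e (<⇒≢ <2N)
  where
  open ≤-Reasoning
  <2N : suc (a + b) < 2 * N
  <2N = begin-strict
    suc (a + b)    <⟨ s≤s (≤-reflexive (sym (+-suc a b))) ⟩
    suc a + suc b  ≤⟨ +-mono-≤ a<N (≰⇒> N≰b) ⟩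
    N + N          ≡⟨ cong (N +_) (+-identityʳ N) ⟨
    2 * N          ∎

≺-byDist : ∀ n {a b c d} → dH n a b < dH n c d → (a , b) ≺[ n ] (c , d)
≺-byDist n dist< = Equivalence.from T-∨ (inj₁ (<⇒<ᵇ dist<))

≺-byFst : ∀ n {a b c d} → dH n a b ≡ dH n c d → a < c → (a , b) ≺[ n ] (c , d)
≺-byFst n {a} {b} {c} {d} dist≡ a<c =
  Equivalence.from T-∨ (inj₂ (Equivalence.from T-∧
    (≡⇒≡ᵇ _ _ dist≡ , Equivalence.from T-∨ (inj₁ (<⇒<ᵇ a<c)))))

≺-inv : ∀ n {a b c d} → (a , b) ≺[ n ] (c , d) → dH n a b < dH n c d ⊎ a < c ⊎ (a ≡ c × b < d)
≺-inv n {a} {b} {c} {d} =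
  Sum.map (<ᵇ⇒< _ _) (lex ∘ proj₂ ∘ Equivalence.to T-∧) ∘ Equivalence.to T-∨
  where
  lex : T ((a <ᵇ c) ∨ ((a ≡ᵇ c) ∧ (b <ᵇ d))) → a < c ⊎ (a ≡ c × b < d)
  lex = Sum.map (<ᵇ⇒< a c) (Product.map (≡ᵇ⇒≡ a c) (<ᵇ⇒< b d) ∘ Equivalence.to T-∧) ∘ Equivalence.to T-∨

antipodalPair : ℕ → ℕ → Pair
antipodalPair n a = a , comp n a

antipodalPair-≺⇔< : ∀ n {a c} → a < 2 ^ n → c < 2 ^ n → antipodalPair n a ≺[ n ] antipodalPair n c ⇔ a < c
antipodalPair-≺⇔< n {a} {c} a< c< = mk⇔ to (≺-byFst n sameDist)
  where
  sameDist : dH n a (comp n a) ≡ dH n c (comp n c)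
  sameDist = trans (dH-comp n a<) (sym (dH-comp n c<))
  to : antipodalPair n a ≺[ n ] antipodalPair n c → a < c
  to a≺c with ≺-inv n a≺c
  ... | inj₁ dist<              = contradiction sameDist (<⇒≢ dist<)
  ... | inj₂ (inj₁ a<c)         = a<c
  ... | inj₂ (inj₂ (refl , b<)) = contradiction b< (<-irrefl refl)

mon-absent : ∀ {a b v} → v ≢ a → v ≢ b → mon (a , b) v ≡ 0
mon-absent v≢a v≢b rewrite ≡ᵇ-≢ v≢a | ≡ᵇ-≢ v≢b = refl

mon-fst-positive : ∀ a b → 0 < mon (a , b) a
mon-fst-positive a b rewrite ≡ᵇ-refl a = s≤s z≤n

mon-∣ₘ : ∀ {a b} (L : Monomial) → a ≢ b → 0 < L a → 0 < L b → mon (a , b) ∣ₘ L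
mon-∣ₘ {a} {b} L a≢b La Lb v with v ≟ a | v ≟ b
... | yes refl | _        rewrite ≡ᵇ-refl v | ≡ᵇ-≢ a≢b = La
... | no v≢a   | yes refl rewrite ≡ᵇ-≢ v≢a  | ≡ᵇ-refl v = Lb
... | no v≢a   | no v≢b   rewrite mon-absent v≢a v≢b    = z≤n

lcmList-++ : ∀ xs ys v → lcmList (xs ++ ys) v ≡ lcmList xs v ⊔ lcmList ys v
lcmList-++ []       ys v = refl
lcmList-++ (g ∷ xs) ys v = trans (cong (mon g v ⊔_) (lcmList-++ xs ys v)) (sym (⊔-assoc (mon g v) _ _))

lcmList-absent : ∀ {xs v} → All (λ g → mon g v ≡ 0) xs → lcmList xs v ≡ 0
lcmList-absent []             = refl
lcmList-absent (g≡0 ∷ xs≡0) = cong₂ _⊔_ g≡0 (lcmList-absent xs≡0)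

fullMon-< : ∀ n {v} → v < 2 ^ n → fullMon n v ≡ 1
fullMon-< n v< rewrite Equivalence.to T-≡ (<⇒<ᵇ v<) = refl

module _ {ℓ} {A : Set ℓ} where

  lookup-++ˡ : ∀ (xs ys : List A) {h} (lt : h < length xs) (lt′ : h < length (xs ++ ys)) →
               lookup (xs ++ ys) (fromℕ< lt′) ≡ lookup xs (fromℕ< lt)
  lookup-++ˡ (x ∷ xs) ys {zero}  _  _   = refl
  lookup-++ˡ (x ∷ xs) ys {suc h} lt lt′ = lookup-++ˡ xs ys (s<s⁻¹ lt) (s<s⁻¹ lt′)

  lookup-++-length : ∀ (xs : List A) y ys (lt : length xs < length (xs ++ y ∷ ys)) →
                     lookup (xs ++ y ∷ ys) (fromℕ< lt) ≡ y
  lookup-++-length []       y ys _  = refl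
  lookup-++-length (x ∷ xs) y ys lt = lookup-++-length xs y ys (s<s⁻¹ lt)

  take-++ˡ : ∀ (xs ys : List A) {h} → h ≤ length xs → take h (xs ++ ys) ≡ take h xs
  take-++ˡ xs       ys {zero}  _   = refl
  take-++ˡ (x ∷ xs) ys {suc h} h≤ = cong (x ∷_) (take-++ˡ xs ys (s≤s⁻¹ h≤))

  take-suc-length : ∀ (xs : List A) y ys → take (suc (length xs)) (xs ++ y ∷ ys) ≡ xs ∷ʳ y
  take-suc-length []       y ys = refl
  take-suc-length (x ∷ xs) y ys = cong (x ∷_) (take-suc-length xs y ys)

  module _ {ℓ′} {R : A → A → Set ℓ′} where

    Linked-++⁻ˡ : ∀ xs {ys} → Linked R (xs ++ ys) → Linked R xs
    Linked-++⁻ˡ []           _           = []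
    Linked-++⁻ˡ (x ∷ [])     _           = [-]
    Linked-++⁻ˡ (x ∷ y ∷ xs) (Rxy ∷ Rxs) = Rxy ∷ Linked-++⁻ˡ (y ∷ xs) Rxs

    Linked-++⁻ʳ : ∀ xs {ys} → Linked R (xs ++ ys) → Linked R ys
    Linked-++⁻ʳ []       Rys = Rys
    Linked-++⁻ʳ (x ∷ xs) Rxs = Linked-++⁻ʳ xs (Linked.tail Rxs)

module _ (n r : ℕ) where

  admissible-++⁻ˡ : ∀ J {S} → Admissible n r (J ++ S) → Admissible n r J
  admissible-++⁻ˡ J {S} adm h h<|J| q q-gen Jh≺q q∣ =
    adm h h<|JS| q q-gen
      (subst (_≺[ n ] q) (sym (lookup-++ˡ J S h<|J| h<|JS|)) Jh≺q)
      (subst (λ K → mon q ∣ₘ lcmList K) (sym (take-++ˡ J S h<|J|)) q∣)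
    where
    h<|JS| = <-≤-trans h<|J| (length-++-≤ˡ J)

  admissibleProduct-++⁻ˡ : ∀ J {S} → AdmissibleProduct n r (J ++ S) → AdmissibleProduct n r J
  admissibleProduct-++⁻ˡ J (gens , linked , adm) =
    AllP.++⁻ˡ J gens , Linked-++⁻ˡ J linked , admissible-++⁻ˡ J adm

  admissible-⊀ : ∀ J {g S q} → Admissible n r (J ++ g ∷ S) → IsGen n r q →
                 mon q ∣ₘ lcmList (J ∷ʳ g) → ¬ (g ≺[ n ] q)
  admissible-⊀ J {g} {S} {q} adm q-gen q∣ g≺q =
    adm (length J) |J|< q q-gen
      (subst (_≺[ n ] q) (sym (lookup-++-length J g S |J|<)) g≺q)
      (subst (λ K → mon q ∣ₘ lcmList K) (sym (take-suc-length J g S)) q∣)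
    where
    |J|< = subst (length J <_) (sym (length-++-sucʳ J g S)) (s≤s (length-++-≤ˡ J))

-- Peeling Θ_n off the end of I

interval : ℕ → ℕ → List ℕ
interval i zero    = []
interval i (suc c) = i ∷ interval (suc i) c

All-interval : ∀ {ℓ} {P : ℕ → Set ℓ} i c → (∀ k → i ≤ k → k < i + c → P k) → All P (interval i c)
All-interval i zero    _ = []
All-interval i (suc c) p =
  p i ≤-refl (m<m+n i z<s) ∷
  All-interval (suc i) c (λ k i<k k< → p k (<⇒≤ i<k) (subst (k <_) (sym (+-suc i c)) k<))

applyUpTo≡interval : ∀ f i c → (∀ x → f x ≡ i + x) → applyUpTo f c ≡ interval i c
applyUpTo≡interval f i zero    _  = refl
applyUpTo≡interval f i (suc c) f≗ =
  cong₂ _∷_ (trans (f≗ 0) (+-identityʳ i))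
            (applyUpTo≡interval (f ∘ suc) (suc i) c (λ x → trans (f≗ (suc x)) (+-suc i x)))

module ThetaSuffix (m r : ℕ) (r<n : r < suc m) (I : List Pair)
                   (admI : AdmissibleProduct (suc m) r I) (full : lcmList I ≈ₘ fullMon (suc m)) where

  private
    n = suc m
    N = 2 ^ m
    θ = antipodalPair n

  suffix : ℕ → ℕ → List Pair
  suffix i c = map θ (interval i c)

  head<N : ∀ {i c} → suc i + c ≡ N → i < N
  head<N {i} {c} e = subst (i <_) e (s≤s (m≤m+n i c))

  <N⇒<2ⁿ : ∀ {i} → i < N → i < 2 ^ n
  <N⇒<2ⁿ i<N = <-≤-trans i<N (m≤m+n N (N + 0))

  comp-upper : ∀ {i} → i < N → N ≤ comp n i
  comp-upper i<N = antipodal-upper (comp-antipodal n (<N⇒<2ⁿ i<N)) i<N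

  θ-gen : ∀ {i} → i < N → IsGen n r (θ i)
  θ-gen {i} i<N =
    <-≤-trans i<N (comp-upper i<N) ,
    antipodal-< (comp-antipodal n (<N⇒<2ⁿ i<N)) ,
    subst (r <_) (sym (dH-comp n (<N⇒<2ⁿ i<N))) r<n

  suffix-lcm-absent : ∀ {i c v} → i + c ≡ N → (∀ k → i ≤ k → k < N → v ≢ k × v ≢ comp n k) →
                      lcmList (suffix i c) v ≡ 0
  suffix-lcm-absent {i} {c} e avoid = lcmList-absent (AllP.map⁺ (All-interval i c
    (λ k i≤k k< → Product.uncurry mon-absent (avoid k i≤k (subst (k <_) e k<)))))

  prefix-lcm-positive : ∀ J S {v} → I ≡ J ++ S → lcmList S v ≡ 0 → v < 2 ^ n → 0 < lcmList J v
  prefix-lcm-positive J S {v} I≡ S≡0 v< = subst (0 <_) 1≡ (s≤s z≤n)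
    where
    open ≡-Reasoning
    1≡ : 1 ≡ lcmList J v
    1≡ = begin
      1                            ≡⟨ fullMon-< n v< ⟨
      fullMon n v                  ≡⟨ full v ⟨
      lcmList I v                  ≡⟨ cong (λ K → lcmList K v) I≡ ⟩
      lcmList (J ++ S) v           ≡⟨ lcmList-++ J S v ⟩
      lcmList J v ⊔ lcmList S v    ≡⟨ cong (lcmList J v ⊔_) S≡0 ⟩
      lcmList J v ⊔ 0              ≡⟨ ⊔-identityʳ (lcmList J v) ⟩
      lcmList J v                  ∎

  θ-divides-prefix : ∀ i c → suc i + c ≡ N → ∀ J → I ≡ J ++ suffix (suc i) c → mon (θ i) ∣ₘ lcmList J
  θ-divides-prefix i c e J I≡ =
    mon-∣ₘ (lcmList J) (<⇒≢ (<-≤-trans i<N (comp-upper i<N)))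
      (prefix-lcm-positive J (suffix (suc i) c) I≡ (suffix-lcm-absent e avoid-i) (<N⇒<2ⁿ i<N))
      (prefix-lcm-positive J (suffix (suc i) c) I≡ (suffix-lcm-absent e avoid-ī)
        (antipodal-< (comp-antipodal n (<N⇒<2ⁿ i<N))))
    where
    i<N = head<N e
    avoid-i : ∀ k → suc i ≤ k → k < N → i ≢ k × i ≢ comp n k
    avoid-i k i<k k<N = <⇒≢ i<k , <⇒≢ (<-≤-trans i<N (comp-upper k<N))
    avoid-ī : ∀ k → suc i ≤ k → k < N → comp n i ≢ k × comp n i ≢ comp n k
    avoid-ī k i<k k<N =
      ≢-sym (<⇒≢ (<-≤-trans k<N (comp-upper i<N))) ,
      <⇒≢ i<k ∘ comp-injective n (<N⇒<2ⁿ i<N) (<N⇒<2ⁿ k<N)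

  factor-gen : ∀ J {g S} → I ≡ J ++ g ∷ S → IsGen n r g
  factor-gen J I≡ = All.head (AllP.++⁻ʳ J (proj₁ (subst (AdmissibleProduct n r) I≡ admI)))

  last-⊀ : ∀ J {g S q} → I ≡ J ++ g ∷ S → IsGen n r q → mon q ∣ₘ lcmList (J ∷ʳ g) → ¬ (g ≺[ n ] q)
  last-⊀ J I≡ = admissible-⊀ n r J (proj₂ (proj₂ (subst (AdmissibleProduct n r) I≡ admI)))

  ⊀θ⇒antipodal : ∀ {i a b} → i < N → IsGen n r (a , b) → ¬ ((a , b) ≺[ n ] θ i) → b ≡ comp n a
  ⊀θ⇒antipodal {i} {a} {b} i<N (a<b , b< , _) ⊀θi = dH≡n⇒≡comp n (<-trans a<b b<) b< dist≡n
    where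
    dist≡n : dH n a b ≡ n
    dist≡n = ≤-antisym (dH≤ n a b)
      (≮⇒≥ (⊀θi ∘ ≺-byDist n ∘ subst (dH n a b <_) (sym (dH-comp n (<N⇒<2ⁿ i<N)))))

  θ-before-suffix : ∀ i c → suc i + c ≡ N → ∀ J a → a < N →
                    Linked (_≺[ n ]_) (J ++ θ a ∷ suffix (suc i) c) → a < suc i
  θ-before-suffix i zero    e J a a<N _      = subst (a <_) (trans (sym e) (+-identityʳ (suc i))) a<N
  θ-before-suffix i (suc c) e J a a<N linked =
    Equivalence.to (antipodalPair-≺⇔< n (<N⇒<2ⁿ a<N) (<N⇒<2ⁿ (subst (suc i <_) e (m<m+n (suc i) z<s))))
      (Linked.head (Linked-++⁻ʳ J linked))

  antipodal-last : ∀ i c → suc i + c ≡ N → ∀ J a → I ≡ J ++ θ a ∷ suffix (suc i) c →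
                   ¬ (θ a ≺[ n ] θ i) → a ≡ i
  antipodal-last i c e J a I≡ ⊀θi with <-cmp a i
  ... | tri< a<i _ _ =
    contradiction (Equivalence.from (antipodalPair-≺⇔< n (<N⇒<2ⁿ a<N) (<N⇒<2ⁿ i<N)) a<i) ⊀θi
    where
    i<N = head<N e
    a<N = <-trans a<i i<N
  ... | tri≈ _ a≡i _ = a≡i
  ... | tri> _ _ i<a = contradiction i<a (≤⇒≯ (s≤s⁻¹ (θ-before-suffix i c e J a a<N linked)))
    where
    a<N = let (a<ā , ā< , _) = factor-gen J I≡ in antipodal-lower (comp-antipodal n (<-trans a<ā ā<)) a<ā
    linked = proj₁ (proj₂ (subst (AdmissibleProduct n r) I≡ admI))

  last-factor : ∀ i c → suc i + c ≡ N → ∀ J g → I ≡ J ++ g ∷ suffix (suc i) c →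
                mon (θ i) ∣ₘ lcmList (J ∷ʳ g) → g ≡ θ i
  last-factor i c e J (a , b) I≡ θi∣ with last-⊀ J I≡ (θ-gen (head<N e)) θi∣
  ... | ⊀θi with ⊀θ⇒antipodal (head<N e) (factor-gen J I≡) ⊀θi
  ...   | refl = cong θ (antipodal-last i c e J a I≡ ⊀θi)

  peel : ∀ i c → suc i + c ≡ N → ∀ J → I ≡ J ++ suffix (suc i) c → ∃[ J′ ] I ≡ J′ ++ suffix i (suc c)
  peel i c e J I≡ with initLast J | θ-divides-prefix i c e J I≡
  ... | []       | θi∣ = contradiction (θi∣ i) (<⇒≱ (mon-fst-positive i (comp n i)))
  ... | J′ ∷ʳ′ g | θi∣ =
    J′ , trans I≡′ (cong (λ h → J′ ++ h ∷ suffix (suc i) c) (last-factor i c e J′ g I≡′ θi∣))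
    where
    I≡′ = trans I≡ (++-assoc J′ (g ∷ []) (suffix (suc i) c))

  peel-all : ∀ c i → i + c ≡ N → ∃[ J ] I ≡ J ++ suffix i c
  peel-all zero    i _ = I , sym (++-identityʳ I)
  peel-all (suc c) i e = let (J , I≡) = peel-all c (suc i) e′ in peel i c e′ J I≡
    where
    e′ = trans (sym (+-suc i c)) e

  thetaList-suffix : ∃[ J ] I ≡ J ++ thetaList n
  thetaList-suffix =
    let (J , I≡) = peel-all N 0 refl
    in J , trans I≡ (cong (λ ks → J ++ map θ ks) (sym (applyUpTo≡interval id 0 N (λ _ → refl))))

length-thetaList : ∀ n → length (thetaList n) ≡ 2 ^ (n ∸ 1)
length-thetaList n = trans (length-map _ (upTo (2 ^ (n ∸ 1)))) (length-upTo (2 ^ (n ∸ 1)))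

mainTheorem7 : (n r s : ℕ) → r < n → (I : List Pair) →
    AdmissibleProduct n r I → length I ≡ s → lcmList I ≈ₘ fullMon n →
    Σ (List Pair) (λ J → AdmissibleProduct n r J × length J ≡ s ∸ 2 ^ (n ∸ 1) ×
      (2 ^ (n ∸ 1) ≤ s) × extProd n I ≡ extProd n (J ++ thetaList n))
mainTheorem7 zero    r s () I admI |I|≡s full
mainTheorem7 (suc m) r s r<n I admI refl full with ThetaSuffix.thetaList-suffix m r r<n I admI full
... | J , I≡ =
  J , admissibleProduct-++⁻ˡ (suc m) r J (subst (AdmissibleProduct (suc m) r) I≡ admI) ,
  sym (trans (cong (_∸ 2 ^ m) |I|≡) (m+n∸n≡m (length J) (2 ^ m))) ,
  subst (2 ^ m ≤_) (sym |I|≡) (m≤n+m (2 ^ m) (length J)) ,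
  cong (extProd (suc m)) I≡
  where
  |I|≡ : length I ≡ length J + 2 ^ m
  |I|≡ = trans (cong length I≡) (trans (length-++ J) (cong (length J +_) (length-thetaList (suc m))))
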